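{- Let $V$ be a vector space over a field of characteristic $0$, and let $(F_{i,j})_{i,j\geq1}$, $(G_{i,j})_{i,j\geq1}$ be families of elements of $V$ whose generating series $F(x,y)=\sum_{i,j\geq1}F_{i,j}x^{i-1}y^{j-1}$ and $G(x,y)=\sum_{i,j\geq1}G_{i,j}x^{i-1}y^{j-1}$ satisfy $F(x,y)=G(x,y)-G(x+y,y)$. Then for all $n\geq2$ and $p\geq1$, \[ G_{n,p}=-\frac{1}{n-1}\sum_{i=0}^{p}\binom{n-2+i}{n-2}\,b_i\,F_{n-1+i,\,p+1-i}. \]
   Context: The Bernoulli numbers $b_i$ are defined by $\frac{u}{e^u-1}=\sum_{i\geq0}b_i\frac{u^i}{i!}$ (so $b_0=1$, $b_1=-\tfrac12$, $b_2=\tfrac16$). Generating series are formal power series in $x,y$ with coefficients in $V$. -}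

module Defs where

open import Level using (Level; _⊔_; suc)
open import Data.Nat as ℕ using (ℕ; zero; _≤ᵇ_)
open import Data.Nat.Combinatorics using (_C_)
open import Data.Bool using (if_then_else_)
open import Relation.Nullary using (¬_)
open import Algebra.Bundles using (CommutativeRing)
open import Algebra.Module.Bundles using (Module)

record Field (c ℓ : Level) : Set (suc (c ⊔ ℓ)) where
  field
    commutativeRing : CommutativeRing c ℓ
  open CommutativeRing commutativeRing public
  field
    1≉0   : ¬ (1# ≈ 0#)
    inv   : (x : Carrier) → ¬ (x ≈ 0#) → Carrier
    inv-r : (x : Carrier) (p : ¬ (x ≈ 0#)) → x * inv x p ≈ 1#

module _ {c ℓ} (K : Field c ℓ) where
  open Field K

  fromℕ : ℕ → Carrier
  fromℕ zero      = 0#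
  fromℕ (ℕ.suc n) = 1# + fromℕ n

  CharZero : Set ℓ
  CharZero = (n : ℕ) → ¬ (fromℕ (ℕ.suc n) ≈ 0#)

  sumK : ℕ → (ℕ → Carrier) → Carrier
  sumK zero      f = 0#
  sumK (ℕ.suc n) f = sumK n f + f n

  -- Bernoulli numbers in K (K of characteristic 0), defined by
  --   u / (e^u - 1) = Σ_i b_i u^i / i!.
  -- Comparing coefficients of u^(m+1)/(m+1)! in u = (e^u - 1) · Σ b_i u^i/i!
  -- gives b_0 = 1 and Σ_{k ≤ m} C(m+1,k) b_k = 0 for m ≥ 1, i.e.
  --   b_m = -(1/(m+1)) Σ_{k < m} C(m+1,k) b_k .
  -- bernUpTo n k is b_k for every k ≤ n.
  module _ (hz : CharZero) where
    bernUpTo : ℕ → ℕ → Carrier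
    bernUpTo zero      k = 1#
    bernUpTo (ℕ.suc n) k =
      if k ≤ᵇ n then bernUpTo n k
      else - (inv (fromℕ (ℕ.suc (ℕ.suc n))) (hz (ℕ.suc n))
               * sumK (ℕ.suc n) (λ j → fromℕ (ℕ.suc (ℕ.suc n) C j) * bernUpTo n j))

    bernoulli : ℕ → Carrier
    bernoulli n = bernUpTo n n

-- Formal power series in x, y with coefficients in a module V:
-- s a b is the coefficient of x^a y^b; equality is coefficientwise.

module _ {r ℓr m ℓm} {R : CommutativeRing r ℓr} (V : Module R m ℓm) where
  open Module V

  Series2 : Set m
  Series2 = ℕ → ℕ → Carrierᴹ

  _≈ˢ_ : Series2 → Series2 → Set ℓm
  s ≈ˢ t = (a b : ℕ) → s a b ≈ᴹ t a b

  _-ˢ_ : Series2 → Series2 → Series2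
  (s -ˢ t) a b = s a b +ᴹ (-ᴹ t a b)

  sumᴹ : ℕ → (ℕ → Carrierᴹ) → Carrierᴹ
  sumᴹ zero      f = 0ᴹ
  sumᴹ (ℕ.suc n) f = sumᴹ n f +ᴹ f n

  -- generating series Σ_{i,j ≥ 1} H_{i,j} x^(i-1) y^(j-1) of a family
  -- (H_{i,j})_{i,j ≥ 1}  (given as H : ℕ → ℕ → V; values at index 0 unused)
  genSeries : (ℕ → ℕ → Carrierᴹ) → Series2
  genSeries H a b = H (ℕ.suc a) (ℕ.suc b)

module _ {c ℓ m ℓm} (K : Field c ℓ) (V : Module (Field.commutativeRing K) m ℓm) where
  open Field K
  open Module V

  -- the substitution s(x,y) ↦ s(x+y, y):
  -- Σ_{i,j} s_{i,j} (x+y)^i y^j = Σ_{i,j} Σ_{a ≤ i} C(i,a) s_{i,j} x^a y^(i-a+j),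
  -- so the coefficient of x^a y^b is Σ_{t=0}^{b} C(a+t,a) s_{a+t, b-t}.
  substXplusY : Series2 V → Series2 V
  substXplusY s a b =
    sumᴹ V (ℕ.suc b) (λ t → fromℕ K ((a ℕ.+ t) C a) *ₗ s (a ℕ.+ t) (b ℕ.∸ t))

{-# OPTIONS --safe #-}
module Submission where

-- Dropping the t = 0 term of the substitution, the hypothesis reads
-- F(a+1, b+1) = - Σ_{1 ≤ t ≤ b} C(a+t, a) G(a+1+t, b+1-t).  Substitute this into the
-- right-hand side (N = n - 2) and exchange the order of summation: since
-- C(N+i, N) C(N+s, N+i) = C(N+s, N) C(s, i), the coefficient of G(N+1+s, p+1-s) becomes
-- - C(N+s, N) Σ_{i < s} C(s, i) b_i, which by the recurrence defining the Bernoulli numbers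
-- is -(N+1) for s = 1 and 0 for s ≥ 2.

open import Defs
open import Data.Nat as ℕ using (ℕ; zero; suc; _+_; _∸_; _≤_; _<_; _≤ᵇ_; s≤s; z≤n)
import Data.Nat.Properties as ℕₚ
open import Data.Nat.Combinatorics using (_C_; nCn≡1)
open import Data.Bool using (true; false)
open import Data.Empty using (⊥-elim)
open import Data.Unit using (tt)
open import Function using (_∘_)
open import Relation.Nullary using (¬_)
open import Relation.Binary.PropositionalEquality as ≡ using (_≡_; cong; cong₂)
open import Algebra.Bundles using (AbelianGroup; CommutativeRing)
open import Algebra.Module.Bundles using (Module)
import Algebra.Module.Properties as ModuleProperties
import Algebra.Properties.AbelianGroup as AbelianGroupProperties
import Algebra.Properties.CommutativeSemigroup as CommutativeSemigroupProperties
import Algebra.Properties.Ring as RingProperties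
import Algebra.Properties.Semiring.Mult as SemiringMult
import Relation.Binary.Reasoning.Setoid as SetoidReasoning

module Binomial where
  open import Data.Nat
  open import Data.Nat.Properties
  open import Data.Nat.Combinatorics
  open import Data.Nat.DivMod using (m/n*n≡m)
  open import Data.Nat.Solver using (module +-*-Solver)
  open import Data.Product using (_,_)
  open import Relation.Binary.PropositionalEquality
  open +-*-Solver using (solve; _:=_; _:*_)
  open ≡-Reasoning

  [m+n]Cm*[m!*n!]≡[m+n]! : ∀ m n → ((m + n) C m) * (m ! * n !) ≡ (m + n) !
  [m+n]Cm*[m!*n!]≡[m+n]! m n = begin
    ((m + n) C m) * (m ! * n !)
      ≡⟨ cong (λ k → ((m + n) C m) * (m ! * k !)) (m+n∸m≡n m n) ⟨
    ((m + n) C m) * (m ! * (m + n ∸ m) !)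
      ≡⟨ cong (_* (m ! * (m + n ∸ m) !)) (nCk≡n!/k![n-k]! (m≤m+n m n)) ⟩
    ((m + n) ! / (m ! * (m + n ∸ m) !)) * (m ! * (m + n ∸ m) !)
      ≡⟨ m/n*n≡m (k![n∸k]!∣n! (m≤m+n m n)) ⟩
    (m + n) ! ∎
    where instance _ = m !* (m + n ∸ m) !≢0

  [m+n]Cm*[m+n+o]C[m+n]≡[m+n+o]Cm*[n+o]Cn : ∀ m n o →
    ((m + n) C m) * ((m + n + o) C (m + n)) ≡ ((m + n + o) C m) * ((n + o) C n)
  [m+n]Cm*[m+n+o]C[m+n]≡[m+n+o]Cm*[n+o]Cn m n o =
    *-cancelʳ-≡ _ _ (m ! * (n ! * o !)) {{m*n≢0 _ _ {{m !≢0}} {{n !* o !≢0}}}}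
      (trans lhs≡[m+n+o]! (sym rhs≡[m+n+o]!))
    where
    x y z w : ℕ
    x = (m + n) C m
    y = (m + n + o) C (m + n)
    z = (m + n + o) C m
    w = (n + o) C n

    lhs≡[m+n+o]! : x * y * (m ! * (n ! * o !)) ≡ (m + n + o) !
    lhs≡[m+n+o]! = begin
      x * y * (m ! * (n ! * o !))
        ≡⟨ solve 5 (λ x y p q r → x :* y :* (p :* (q :* r)) := y :* (x :* (p :* q) :* r))
                 refl x y (m !) (n !) (o !) ⟩
      y * (x * (m ! * n !) * o !)     ≡⟨ cong (λ k → y * (k * o !)) ([m+n]Cm*[m!*n!]≡[m+n]! m n) ⟩
      y * ((m + n) ! * o !)           ≡⟨ [m+n]Cm*[m!*n!]≡[m+n]! (m + n) o ⟩
      (m + n + o) !                   ∎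

    rhs≡[m+n+o]! : z * w * (m ! * (n ! * o !)) ≡ (m + n + o) !
    rhs≡[m+n+o]! = begin
      z * w * (m ! * (n ! * o !))
        ≡⟨ solve 5 (λ z w p q r → z :* w :* (p :* (q :* r)) := z :* (p :* (w :* (q :* r))))
                 refl z w (m !) (n !) (o !) ⟩
      z * (m ! * (w * (n ! * o !)))   ≡⟨ cong (λ k → z * (m ! * k)) ([m+n]Cm*[m!*n!]≡[m+n]! n o) ⟩
      z * (m ! * (n + o) !)           ≡⟨ cong (λ k → (k C m) * (m ! * (n + o) !)) (+-assoc m n o) ⟩
      ((m + (n + o)) C m) * (m ! * (n + o) !) ≡⟨ [m+n]Cm*[m!*n!]≡[m+n]! m (n + o) ⟩
      (m + (n + o)) !                 ≡⟨ cong _! (+-assoc m n o) ⟨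
      (m + n + o) !                   ∎

  [m+k]Cm*[m+n]C[m+k]≡[m+n]Cm*nCk : ∀ m {k n} → k ≤ n →
    ((m + k) C m) * ((m + n) C (m + k)) ≡ ((m + n) C m) * (n C k)
  [m+k]Cm*[m+n]C[m+k]≡[m+n]Cm*nCk m {k} k≤n with m≤n⇒∃[o]m+o≡n k≤n
  ... | o , refl rewrite sym (+-assoc m k o) = [m+n]Cm*[m+n+o]C[m+n]≡[m+n+o]Cm*[n+o]Cn m k o

  [1+n]Cn≡1+n : ∀ n → suc n C n ≡ suc n
  [1+n]Cn≡1+n n = begin
    suc n C n             ≡⟨ nCk≡nC[n∸k] (n≤1+n n) ⟩
    suc n C (suc n ∸ n)   ≡⟨ cong (suc n C_) (m+n∸n≡m 1 n) ⟩
    suc n C 1             ≡⟨ nC1≡n (suc n) ⟩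
    suc n                 ∎

open Binomial

module _ {a ℓa b ℓb} {R : CommutativeRing a ℓa} (V : Module R b ℓb) where
  open Module V
  open ModuleProperties V using (inverseʳ-uniqueᴹ)
  open AbelianGroupProperties +ᴹ-abelianGroup using (ε⁻¹≈ε; ⁻¹-∙-comm)
  open CommutativeSemigroupProperties (AbelianGroup.commutativeSemigroup +ᴹ-abelianGroup)
    using (interchange)
  open SetoidReasoning ≈ᴹ-setoid

  -ᴹ‿distribʳ-*ₗ : ∀ r x → -ᴹ (r *ₗ x) ≈ᴹ r *ₗ (-ᴹ x)
  -ᴹ‿distribʳ-*ₗ r x = ≈ᴹ-sym (inverseʳ-uniqueᴹ (r *ₗ x) (r *ₗ (-ᴹ x)) (begin
    r *ₗ x +ᴹ r *ₗ (-ᴹ x)  ≈⟨ *ₗ-distribˡ r x (-ᴹ x) ⟨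
    r *ₗ (x +ᴹ -ᴹ x)       ≈⟨ *ₗ-congˡ (-ᴹ‿inverseʳ x) ⟩
    r *ₗ 0ᴹ                ≈⟨ *ₗ-zeroʳ r ⟩
    0ᴹ                     ∎))

  sumᴹ-cong : ∀ n {f h : ℕ → Carrierᴹ} → (∀ i → i < n → f i ≈ᴹ h i) → sumᴹ V n f ≈ᴹ sumᴹ V n h
  sumᴹ-cong zero    f≈h = ≈ᴹ-refl
  sumᴹ-cong (suc n) f≈h = +ᴹ-cong (sumᴹ-cong n (λ i i<n → f≈h i (ℕₚ.m<n⇒m<1+n i<n))) (f≈h n (ℕₚ.n<1+n n))

  sumᴹ-zero : ∀ n {f : ℕ → Carrierᴹ} → (∀ i → i < n → f i ≈ᴹ 0ᴹ) → sumᴹ V n f ≈ᴹ 0ᴹ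
  sumᴹ-zero zero    f≈0 = ≈ᴹ-refl
  sumᴹ-zero (suc n) f≈0 = ≈ᴹ-trans
    (+ᴹ-cong (sumᴹ-zero n (λ i i<n → f≈0 i (ℕₚ.m<n⇒m<1+n i<n))) (f≈0 n (ℕₚ.n<1+n n)))
    (+ᴹ-identityˡ 0ᴹ)

  sumᴹ-first : ∀ n (f : ℕ → Carrierᴹ) → sumᴹ V (suc n) f ≈ᴹ f 0 +ᴹ sumᴹ V n (f ∘ suc)
  sumᴹ-first zero    f = ≈ᴹ-trans (+ᴹ-identityˡ (f 0)) (≈ᴹ-sym (+ᴹ-identityʳ (f 0)))
  sumᴹ-first (suc n) f = ≈ᴹ-trans (+ᴹ-congʳ (sumᴹ-first n f)) (+ᴹ-assoc _ _ _)

  sumᴹ-distrib-+ᴹ : ∀ n (f h : ℕ → Carrierᴹ) →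
    sumᴹ V n (λ i → f i +ᴹ h i) ≈ᴹ sumᴹ V n f +ᴹ sumᴹ V n h
  sumᴹ-distrib-+ᴹ zero    f h = ≈ᴹ-sym (+ᴹ-identityˡ 0ᴹ)
  sumᴹ-distrib-+ᴹ (suc n) f h = ≈ᴹ-trans (+ᴹ-congʳ (sumᴹ-distrib-+ᴹ n f h)) (interchange _ _ _ _)

  sumᴹ-distrib--ᴹ : ∀ n (f : ℕ → Carrierᴹ) → sumᴹ V n (λ i → -ᴹ f i) ≈ᴹ -ᴹ sumᴹ V n f
  sumᴹ-distrib--ᴹ zero    f = ≈ᴹ-sym ε⁻¹≈ε
  sumᴹ-distrib--ᴹ (suc n) f = ≈ᴹ-trans (+ᴹ-congʳ (sumᴹ-distrib--ᴹ n f)) (⁻¹-∙-comm _ _)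

  *ₗ-distribˡ-sumᴹ : ∀ n r (f : ℕ → Carrierᴹ) → r *ₗ sumᴹ V n f ≈ᴹ sumᴹ V n (λ i → r *ₗ f i)
  *ₗ-distribˡ-sumᴹ zero    r f = *ₗ-zeroʳ r
  *ₗ-distribˡ-sumᴹ (suc n) r f = ≈ᴹ-trans (*ₗ-distribˡ r _ _) (+ᴹ-congʳ (*ₗ-distribˡ-sumᴹ n r f))

  sumᴹ-row-suc : ∀ {i n} (h : ℕ → Carrierᴹ) → i ≤ n →
    sumᴹ V (suc n ∸ i) (λ j → h (i + j)) ≈ᴹ sumᴹ V (n ∸ i) (λ j → h (i + j)) +ᴹ h n
  sumᴹ-row-suc {i} h i≤n
    rewrite ℕₚ.+-∸-assoc 1 i≤n = +ᴹ-congˡ (≈ᴹ-reflexive (cong h (ℕₚ.m+[n∸m]≡n i≤n)))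

  -- Both sides sum f i s over the triangle i ≤ s < n, by rows and by columns.
  sumᴹ-triangle : ∀ n (f : ℕ → ℕ → Carrierᴹ) →
    sumᴹ V n (λ i → sumᴹ V (n ∸ i) (λ j → f i (i + j))) ≈ᴹ sumᴹ V n (λ s → sumᴹ V (suc s) (λ i → f i s))
  sumᴹ-triangle zero    f = ≈ᴹ-refl
  sumᴹ-triangle (suc n) f = begin
    sumᴹ V n (λ i → row (suc n) i) +ᴹ row (suc n) n
      ≈⟨ +ᴹ-cong (sumᴹ-cong n (λ i i<n → sumᴹ-row-suc (f i) (ℕₚ.<⇒≤ i<n))) last-row ⟩
    sumᴹ V n (λ i → row n i +ᴹ f i n) +ᴹ f n n
      ≈⟨ +ᴹ-congʳ (sumᴹ-distrib-+ᴹ n (row n) (λ i → f i n)) ⟩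
    (sumᴹ V n (row n) +ᴹ sumᴹ V n (λ i → f i n)) +ᴹ f n n
      ≈⟨ +ᴹ-assoc _ _ _ ⟩
    sumᴹ V n (row n) +ᴹ sumᴹ V (suc n) (λ i → f i n)
      ≈⟨ +ᴹ-congʳ (sumᴹ-triangle n f) ⟩
    sumᴹ V n (λ s → sumᴹ V (suc s) (λ i → f i s)) +ᴹ sumᴹ V (suc n) (λ i → f i n) ∎
    where
    row : ℕ → ℕ → Carrierᴹ
    row m i = sumᴹ V (m ∸ i) (λ j → f i (i + j))

    last-row : row (suc n) n ≈ᴹ f n n
    last-row rewrite ℕₚ.m+n∸n≡m 1 n | ℕₚ.+-identityʳ n = +ᴹ-identityˡ (f n n)

module _ {c ℓ} (K : Field c ℓ) where
  open Field K renaming (_+_ to _+ᴷ_; _*_ to _*ᴷ_)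
  open SemiringMult semiring using (_×_; ×1-homo-*)
  open RingProperties ring using (-‿distribʳ-*)
  open SetoidReasoning setoid

  fromℕ≈×1 : ∀ n → fromℕ K n ≈ n × 1#
  fromℕ≈×1 zero    = refl
  fromℕ≈×1 (suc n) = +-congˡ (fromℕ≈×1 n)

  fromℕ-homo-* : ∀ m n → fromℕ K (m ℕ.* n) ≈ fromℕ K m *ᴷ fromℕ K n
  fromℕ-homo-* m n = begin
    fromℕ K (m ℕ.* n)           ≈⟨ fromℕ≈×1 (m ℕ.* n) ⟩
    (m ℕ.* n) × 1#              ≈⟨ ×1-homo-* m n ⟩
    (m × 1#) *ᴷ (n × 1#)        ≈⟨ *-cong (fromℕ≈×1 m) (fromℕ≈×1 n) ⟨
    fromℕ K m *ᴷ fromℕ K n      ∎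

  [m+k]Cm*x*[m+n]C[m+k]≈[m+n]Cm*[nCk*x] : ∀ m {k n} x → k ≤ n →
    (fromℕ K ((m + k) C m) *ᴷ x) *ᴷ fromℕ K ((m + n) C (m + k)) ≈
    fromℕ K ((m + n) C m) *ᴷ (fromℕ K (n C k) *ᴷ x)
  [m+k]Cm*x*[m+n]C[m+k]≈[m+n]Cm*[nCk*x] m {k} {n} x k≤n = begin
    (fromℕ K a *ᴷ x) *ᴷ fromℕ K b
      ≈⟨ trans (*-assoc _ _ _) (trans (*-congˡ (*-comm x _)) (sym (*-assoc _ _ _))) ⟩
    (fromℕ K a *ᴷ fromℕ K b) *ᴷ x
      ≈⟨ *-congʳ (fromℕ-homo-* a b) ⟨
    fromℕ K (a ℕ.* b) *ᴷ x
      ≈⟨ *-congʳ (reflexive (cong (fromℕ K) ([m+k]Cm*[m+n]C[m+k]≡[m+n]Cm*nCk m k≤n))) ⟩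
    fromℕ K (c′ ℕ.* d) *ᴷ x
      ≈⟨ *-congʳ (fromℕ-homo-* c′ d) ⟩
    (fromℕ K c′ *ᴷ fromℕ K d) *ᴷ x
      ≈⟨ *-assoc _ _ _ ⟩
    fromℕ K c′ *ᴷ (fromℕ K d *ᴷ x) ∎
    where
    a b c′ d : ℕ
    a = (m + k) C m
    b = (m + n) C (m + k)
    c′ = (m + n) C m
    d = n C k

  sumK-cong : ∀ n {f h : ℕ → Carrier} → (∀ i → i < n → f i ≈ h i) → sumK K n f ≈ sumK K n h
  sumK-cong zero    f≈h = refl
  sumK-cong (suc n) f≈h = +-cong (sumK-cong n (λ i i<n → f≈h i (ℕₚ.m<n⇒m<1+n i<n))) (f≈h n (ℕₚ.n<1+n n))

  *-distribˡ-sumK : ∀ n x (f : ℕ → Carrier) → x *ᴷ sumK K n f ≈ sumK K n (λ i → x *ᴷ f i)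
  *-distribˡ-sumK zero    x f = zeroʳ x
  *-distribˡ-sumK (suc n) x f = trans (distribˡ x _ _) (+-congʳ (*-distribˡ-sumK n x f))

  module _ (hz : CharZero K) where

    bernUpTo-suc : ∀ {n k} → k ≤ n → bernUpTo K hz (suc n) k ≡ bernUpTo K hz n k
    bernUpTo-suc {n} {k} k≤n with k ≤ᵇ n | ℕₚ.≤⇒≤ᵇ k≤n
    ... | true  | _ = ≡.refl
    ... | false | ()

    bernUpTo-+ : ∀ d k → bernUpTo K hz (d + k) k ≡ bernoulli K hz k
    bernUpTo-+ zero    k = ≡.refl
    bernUpTo-+ (suc d) k = ≡.trans (bernUpTo-suc (ℕₚ.m≤n+m k d)) (bernUpTo-+ d k)

    bernUpTo-stable : ∀ {n k} → k ≤ n → bernUpTo K hz n k ≡ bernoulli K hz k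
    bernUpTo-stable {n} {k} k≤n =
      ≡.subst (λ m → bernUpTo K hz m k ≡ bernoulli K hz k) (ℕₚ.m∸n+n≡m k≤n) (bernUpTo-+ (n ∸ k) k)

    bernoulli-suc : ∀ n → bernoulli K hz (suc n) ≡
      - (inv (fromℕ K (suc (suc n))) (hz (suc n))
          *ᴷ sumK K (suc n) (λ j → fromℕ K (suc (suc n) C j) *ᴷ bernUpTo K hz n j))
    bernoulli-suc n with suc n ≤ᵇ n | ℕₚ.≤ᵇ⇒≤ (suc n) n
    ... | false | _     = ≡.refl
    ... | true  | 1+n≤n = ⊥-elim (ℕₚ.n≮n n (1+n≤n tt))

    bernoulli-recurrence : ∀ n →
      sumK K (suc (suc n)) (λ k → fromℕ K (suc (suc n) C k) *ᴷ bernoulli K hz k) ≈ 0#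
    bernoulli-recurrence n = begin
      sumK K (suc n) t +ᴷ fromℕ K (suc (suc n) C suc n) *ᴷ bernoulli K hz (suc n)
        ≈⟨ +-congˡ (*-cong (reflexive (cong (fromℕ K) ([1+n]Cn≡1+n (suc n)))) (reflexive (bernoulli-suc n))) ⟩
      sumK K (suc n) t +ᴷ q *ᴷ - (inv q (hz (suc n)) *ᴷ T)
        ≈⟨ +-congˡ (-‿distribʳ-* q _) ⟨
      sumK K (suc n) t +ᴷ - (q *ᴷ (inv q (hz (suc n)) *ᴷ T))
        ≈⟨ +-congˡ (-‿cong (trans (sym (*-assoc _ _ _)) (trans (*-congʳ (inv-r q (hz (suc n)))) (*-identityˡ T)))) ⟩
      sumK K (suc n) t +ᴷ - T
        ≈⟨ +-congˡ (-‿cong (sumK-cong (suc n) λ i i≤n →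
             *-congˡ (reflexive (bernUpTo-stable (ℕₚ.≤-pred i≤n))))) ⟩
      sumK K (suc n) t +ᴷ - sumK K (suc n) t
        ≈⟨ -‿inverseʳ _ ⟩
      0# ∎
      where
      q : Carrier
      q = fromℕ K (suc (suc n))
      t : ℕ → Carrier
      t k = fromℕ K (suc (suc n) C k) *ᴷ bernoulli K hz k
      T : Carrier
      T = sumK K (suc n) (λ j → fromℕ K (suc (suc n) C j) *ᴷ bernUpTo K hz n j)

module _ {c ℓ m ℓm} (K : Field c ℓ) (V : Module (Field.commutativeRing K) m ℓm) where
  open Field K renaming (_+_ to _+ᴷ_; _*_ to _*ᴷ_)
  open Module V
  open AbelianGroupProperties +ᴹ-abelianGroup using (⁻¹-involutive; ⁻¹-∙-comm)
  open SetoidReasoning ≈ᴹ-setoid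

  *ₗ-distribʳ-sumK : ∀ n (r : ℕ → Carrier) x → sumᴹ V n (λ i → r i *ₗ x) ≈ᴹ sumK K n r *ₗ x
  *ₗ-distribʳ-sumK zero    r x = ≈ᴹ-sym (*ₗ-zeroˡ x)
  *ₗ-distribʳ-sumK (suc n) r x = ≈ᴹ-trans (+ᴹ-congʳ (*ₗ-distribʳ-sumK n r x)) (≈ᴹ-sym (*ₗ-distribʳ x _ _))

  y≈-r*ₗx⇒x≈-r⁻¹*ₗy : ∀ {r x y} (r≉0 : ¬ (r ≈ 0#)) → y ≈ᴹ -ᴹ (r *ₗ x) → x ≈ᴹ -ᴹ (inv r r≉0 *ₗ y)
  y≈-r*ₗx⇒x≈-r⁻¹*ₗy {r} {x} {y} r≉0 y≈-rx = ≈ᴹ-sym (begin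
    -ᴹ (r⁻¹ *ₗ y)             ≈⟨ -ᴹ‿cong (*ₗ-congˡ y≈-rx) ⟩
    -ᴹ (r⁻¹ *ₗ -ᴹ (r *ₗ x))   ≈⟨ -ᴹ‿cong (-ᴹ‿distribʳ-*ₗ V r⁻¹ (r *ₗ x)) ⟨
    -ᴹ -ᴹ (r⁻¹ *ₗ (r *ₗ x))   ≈⟨ ⁻¹-involutive _ ⟩
    r⁻¹ *ₗ (r *ₗ x)           ≈⟨ *ₗ-assoc r⁻¹ r x ⟨
    (r⁻¹ *ᴷ r) *ₗ x           ≈⟨ *ₗ-congʳ (trans (*-comm r⁻¹ r) (inv-r r r≉0)) ⟩
    1# *ₗ x                   ≈⟨ *ₗ-identityˡ x ⟩
    x                         ∎)
    where
    r⁻¹ : Carrier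
    r⁻¹ = inv r r≉0

  module _ {f g : Series2 V} (f≈g-g[x+y,y] : _≈ˢ_ V f (_-ˢ_ V g (substXplusY K V g))) where

    f-expansion : ∀ a b →
      f a b ≈ᴹ -ᴹ sumᴹ V b (λ t → fromℕ K ((a + suc t) C a) *ₗ g (a + suc t) (b ∸ suc t))
    f-expansion a b = begin
      f a b                                ≈⟨ f≈g-g[x+y,y] a b ⟩
      g a b +ᴹ -ᴹ sumᴹ V (suc b) term      ≈⟨ +ᴹ-congˡ (-ᴹ‿cong (sumᴹ-first V b term)) ⟩
      g a b +ᴹ -ᴹ (term 0 +ᴹ rest)         ≈⟨ +ᴹ-congˡ (-ᴹ‿cong (+ᴹ-congʳ term0≈g)) ⟩
      g a b +ᴹ -ᴹ (g a b +ᴹ rest)          ≈⟨ +ᴹ-congˡ (⁻¹-∙-comm (g a b) rest) ⟨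
      g a b +ᴹ (-ᴹ g a b +ᴹ -ᴹ rest)        ≈⟨ +ᴹ-assoc _ _ _ ⟨
      (g a b +ᴹ -ᴹ g a b) +ᴹ -ᴹ rest       ≈⟨ +ᴹ-congʳ (-ᴹ‿inverseʳ (g a b)) ⟩
      0ᴹ +ᴹ -ᴹ rest                        ≈⟨ +ᴹ-identityˡ _ ⟩
      -ᴹ rest                              ∎
      where
      term : ℕ → Carrierᴹ
      term t = fromℕ K ((a + t) C a) *ₗ g (a + t) (b ∸ t)
      rest : Carrierᴹ
      rest = sumᴹ V b (term ∘ suc)
      term0≈g : term 0 ≈ᴹ g a b
      term0≈g rewrite ℕₚ.+-identityʳ a | nCn≡1 a = ≈ᴹ-trans (*ₗ-congʳ (+-identityʳ 1#)) (*ₗ-identityˡ (g a b))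

    -- With n = N + 2 and p = P + 1, column s collects the multiples of
    -- g (N + 1 + s) (P - s) = G (n + s) (p - s).
    module _ (hz : CharZero K) (N P : ℕ) where
      open AbelianGroupProperties +ᴹ-abelianGroup using (ε⁻¹≈ε)

      weight : ℕ → Carrier
      weight i = fromℕ K ((N + i) C N) *ᴷ bernoulli K hz i

      term : ℕ → Carrierᴹ
      term i = weight i *ₗ f (N + i) (suc P ∸ i)

      summand : ℕ → ℕ → Carrierᴹ
      summand i s = (weight i *ᴷ fromℕ K ((N + suc s) C (N + i))) *ₗ g (N + suc s) (P ∸ s)

      coefficient : ℕ → Carrier
      coefficient s = sumK K (suc s) (λ i → weight i *ᴷ fromℕ K ((N + suc s) C (N + i)))

      column : ℕ → Carrierᴹ
      column s = coefficient s *ₗ g (N + suc s) (P ∸ s)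

      last-term≈0 : term (suc P) ≈ᴹ 0ᴹ
      last-term≈0 = begin
        weight (suc P) *ₗ f (N + suc P) (P ∸ P)
          ≈⟨ *ₗ-congˡ (≈ᴹ-reflexive (cong (f (N + suc P)) (ℕₚ.n∸n≡0 P))) ⟩
        weight (suc P) *ₗ f (N + suc P) 0
          ≈⟨ *ₗ-congˡ (≈ᴹ-trans (f-expansion (N + suc P) 0) ε⁻¹≈ε) ⟩
        weight (suc P) *ₗ 0ᴹ
          ≈⟨ *ₗ-zeroʳ (weight (suc P)) ⟩
        0ᴹ ∎

      term≈-sum-summands : ∀ i → term i ≈ᴹ -ᴹ sumᴹ V (suc P ∸ i) (λ j → summand i (i + j))
      term≈-sum-summands i = begin
        weight i *ₗ f (N + i) (suc P ∸ i)
          ≈⟨ *ₗ-congˡ (f-expansion (N + i) (suc P ∸ i)) ⟩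
        weight i *ₗ -ᴹ sumᴹ V (suc P ∸ i) h
          ≈⟨ -ᴹ‿distribʳ-*ₗ V (weight i) _ ⟨
        -ᴹ (weight i *ₗ sumᴹ V (suc P ∸ i) h)
          ≈⟨ -ᴹ‿cong (*ₗ-distribˡ-sumᴹ V (suc P ∸ i) (weight i) h) ⟩
        -ᴹ sumᴹ V (suc P ∸ i) (λ j → weight i *ₗ h j)
          ≈⟨ -ᴹ‿cong (sumᴹ-cong V (suc P ∸ i) λ j _ → weight*ₗh≈summand j) ⟩
        -ᴹ sumᴹ V (suc P ∸ i) (λ j → summand i (i + j)) ∎
        where
        h : ℕ → Carrierᴹ
        h t = fromℕ K ((N + i + suc t) C (N + i)) *ₗ g (N + i + suc t) (suc P ∸ i ∸ suc t)

        weight*ₗh≈summand : ∀ j → weight i *ₗ h j ≈ᴹ summand i (i + j)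
        weight*ₗh≈summand j = ≈ᴹ-trans (≈ᴹ-sym (*ₗ-assoc _ _ _)) (≈ᴹ-reflexive
          (cong₂ (λ u v → (weight i *ᴷ fromℕ K (u C (N + i))) *ₗ g u v)
            (≡.trans (ℕₚ.+-assoc N i (suc j)) (cong (N +_) (ℕₚ.+-suc i j)))
            (≡.trans (ℕₚ.∸-+-assoc (suc P) i (suc j)) (cong (suc P ∸_) (ℕₚ.+-suc i j)))))

      sum-terms≈-sum-columns : sumᴹ V (suc (suc P)) term ≈ᴹ -ᴹ sumᴹ V (suc P) column
      sum-terms≈-sum-columns = begin
        sumᴹ V (suc P) term +ᴹ term (suc P)
          ≈⟨ ≈ᴹ-trans (+ᴹ-congˡ last-term≈0) (+ᴹ-identityʳ _) ⟩
        sumᴹ V (suc P) term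
          ≈⟨ sumᴹ-cong V (suc P) (λ i _ → term≈-sum-summands i) ⟩
        sumᴹ V (suc P) (λ i → -ᴹ sumᴹ V (suc P ∸ i) (λ j → summand i (i + j)))
          ≈⟨ sumᴹ-distrib--ᴹ V (suc P) _ ⟩
        -ᴹ sumᴹ V (suc P) (λ i → sumᴹ V (suc P ∸ i) (λ j → summand i (i + j)))
          ≈⟨ -ᴹ‿cong (sumᴹ-triangle V (suc P) summand) ⟩
        -ᴹ sumᴹ V (suc P) (λ s → sumᴹ V (suc s) (λ i → summand i s))
          ≈⟨ -ᴹ‿cong (sumᴹ-cong V (suc P) λ s _ → *ₗ-distribʳ-sumK (suc s) _ _) ⟩
        -ᴹ sumᴹ V (suc P) column ∎

      coefficient≈ : ∀ s → coefficient s ≈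
        fromℕ K ((N + suc s) C N) *ᴷ sumK K (suc s) (λ i → fromℕ K (suc s C i) *ᴷ bernoulli K hz i)
      coefficient≈ s = trans
        (sumK-cong K (suc s) λ i i<1+s →
          [m+k]Cm*x*[m+n]C[m+k]≈[m+n]Cm*[nCk*x] K N (bernoulli K hz i) (ℕₚ.<⇒≤ i<1+s))
        (sym (*-distribˡ-sumK K (suc s) _ _))

      coefficient-zero : coefficient 0 ≈ fromℕ K (suc N)
      coefficient-zero = trans (coefficient≈ 0)
        (trans (*-congˡ b₀≈1) (trans (*-identityʳ _) (reflexive (cong (fromℕ K) [N+1]CN≡1+N))))
        where
        b₀≈1 : sumK K 1 (λ i → fromℕ K (1 C i) *ᴷ bernoulli K hz i) ≈ 1#
        b₀≈1 = trans (+-identityˡ _) (trans (*-identityʳ _) (+-identityʳ 1#))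
        [N+1]CN≡1+N : (N + 1) C N ≡ suc N
        [N+1]CN≡1+N = ≡.trans (cong (_C N) (ℕₚ.+-comm N 1)) ([1+n]Cn≡1+n N)

      coefficient-suc : ∀ s → coefficient (suc s) ≈ 0#
      coefficient-suc s =
        trans (coefficient≈ (suc s)) (trans (*-congˡ (bernoulli-recurrence K hz s)) (zeroʳ _))

      sum-columns≈first : sumᴹ V (suc P) column ≈ᴹ fromℕ K (suc N) *ₗ g (suc N) P
      sum-columns≈first = begin
        sumᴹ V (suc P) column
          ≈⟨ sumᴹ-first V P column ⟩
        column 0 +ᴹ sumᴹ V P (column ∘ suc)
          ≈⟨ +ᴹ-cong first-column (sumᴹ-zero V P λ s _ →
               ≈ᴹ-trans (*ₗ-congʳ (coefficient-suc s)) (*ₗ-zeroˡ _)) ⟩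
        fromℕ K (suc N) *ₗ g (suc N) P +ᴹ 0ᴹ
          ≈⟨ +ᴹ-identityʳ _ ⟩
        fromℕ K (suc N) *ₗ g (suc N) P ∎
        where
        first-column : column 0 ≈ᴹ fromℕ K (suc N) *ₗ g (suc N) P
        first-column = *ₗ-cong coefficient-zero (≈ᴹ-reflexive (cong (λ a → g a P) (ℕₚ.+-comm N 1)))

      substXplusY-inversion : sumᴹ V (suc (suc P)) term ≈ᴹ -ᴹ (fromℕ K (suc N) *ₗ g (suc N) P)
      substXplusY-inversion = ≈ᴹ-trans sum-terms≈-sum-columns (-ᴹ‿cong sum-columns≈first)

mainTheorem3 : ∀ {c ℓ m ℓm} (K : Field c ℓ) (hz : CharZero K)
    (V : Module (Field.commutativeRing K) m ℓm)
    (F G : ℕ → ℕ → Module.Carrierᴹ V) →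
    _≈ˢ_ V (genSeries V F) (_-ˢ_ V (genSeries V G) (substXplusY K V (genSeries V G))) →
    (n p : ℕ) → 2 ≤ n → 1 ≤ p →
    Module._≈ᴹ_ V (G n p)
      (Module.-ᴹ_ V
        (Module._*ₗ_ V (Field.inv K (fromℕ K (suc (n ∸ 2))) (hz (n ∸ 2)))
          (sumᴹ V (suc p) (λ i →
            Module._*ₗ_ V
              (Field._*_ K (fromℕ K ((n ∸ 2 + i) C (n ∸ 2))) (bernoulli K hz i))
              (F (n ∸ 1 + i) (p + 1 ∸ i))))))
mainTheorem3 K hz V F G F≈G-G[x+y,y] (suc (suc N)) (suc P) (s≤s (s≤s z≤n)) (s≤s z≤n) =
  y≈-r*ₗx⇒x≈-r⁻¹*ₗy K V (hz N) (≈ᴹ-trans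
    (sumᴹ-cong V (suc (suc P)) λ i i<2+P →
      *ₗ-congˡ (≈ᴹ-reflexive (cong (F (suc (N + i))) (reindex i<2+P))))
    (substXplusY-inversion K V F≈G-G[x+y,y] hz N P))
  where
  open Module V using (≈ᴹ-trans; ≈ᴹ-reflexive; *ₗ-congˡ)
  reindex : ∀ {i} → i < suc (suc P) → suc P + 1 ∸ i ≡ suc (suc P ∸ i)
  reindex i<2+P = ≡.trans (ℕₚ.+-∸-comm 1 (ℕₚ.≤-pred i<2+P)) (ℕₚ.+-comm _ 1)
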